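{- Let $0\le r\le n$ and let $\mathcal{G}(n,r)$ be the $\mathbb{Q}$-vector space of formal linear combinations of the symbols $[\underline{r}]$, where $\underline{r}$ ranges over all length-$n$ $(0,1)$-sequences with exactly $r$ ones. Then the $\mathcal{G}$-invariants $\mathcal{G}(F(\underline{r}))$ of the freedom matroids $F(\underline{r})$, as $\underline{r}$ ranges over all length-$n$ $(0,1)$-sequences with exactly $r$ ones, form a basis of $\mathcal{G}(n,r)$.
   Context: For a rank-$r$ matroid $M$ on $\{1,\ldots,n\}$ and a permutation $\pi$ of $\{1,\ldots,n\}$, the rank sequence $\underline{r}(\pi)=(r_1,\ldots,r_n)$ is given by $r_1=r(\{\pi(1)\})$ and $r_j=r(\{\pi(1),\ldots,\pi(j)\})-r(\{\pi(1),\ldots,\pi(j-1)\})$ for $j\ge2$ (a $(0,1)$-sequence with $r$ ones). The symbols $[\underline{r}]$ are linearly independent formal symbols, and the $\mathcal{G}$-invariant is $\mathcal{G}(M)=\sum_\pi[\underline{r}(\pi)]$ over all $n!$ permutations; thus $\mathcal{G}(M)\in\mathcal{G}(n,r)$. For a length-$n$ $(0,1)$-sequence $\underline{r}$ with ones in positions $b_1<b_2<\cdots<b_r$, the freedom matroid $F(\underline{r})$ is the rank-$r$ matroid on $\{1,\ldots,n\}$ in which $1,\ldots,b_1-1$ are loops; for $1\le j\le r-1$, $b_j$ is added as an isthmus and $b_j+1,\ldots,b_{j+1}-1$ are added freely (in general position) in the flat $\mathrm{cl}(\{b_1,\ldots,b_j\})$; and $b_r,b_r+1,\ldots,n$ are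 added freely in the whole matroid. Equivalently, $S\subseteq\{1,\ldots,n\}$ is independent in $F(\underline{r})$ iff $|S\cap\{1,\ldots,i\}|\le r_1+\cdots+r_i$ for every $i$. -}

module Defs where

open import Data.Bool using (Bool; true; false; if_then_else_)
open import Data.Nat using (ℕ; zero; suc; _∸_; _⊔_; _≤_; _≤ᵇ_; _≡ᵇ_)
open import Data.Fin using (Fin; toℕ)
open import Data.Fin.Subset using (Subset; ⁅_⁆; _∪_; ⊥; _⊆_; ∣_∣)
open import Data.List using (List; []; _∷_; map; concatMap; foldr; take; filter; length)
open import Data.List.Base using (allFin)
open import Data.Vec using (Vec; []; _∷_; toList; tabulate)
open import Data.Rational using (ℚ; 0ℚ; _+_; _*_; _/_)
import Data.Integer as ℤ
open import Relation.Nullary using (Dec; yes; no)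
open import Relation.Nullary.Decidable using (⌊_⌋)
open import Relation.Binary.PropositionalEquality using (_≡_)
open import Data.Vec.Properties using (≡-dec)
open import Data.Bool.Properties using () renaming (_≟_ to _≟B_)
open import Data.Fin.Properties using (all?) renaming (_≟_ to _≟F_)
open import Data.Fin.Subset.Properties using (_⊆?_)
open import Data.Nat.Properties using (_≤?_)
open import Data.List.Relation.Unary.Unique.Propositional using (Unique)
import Data.List.Relation.Unary.Unique.DecPropositional as UD

ones : List Bool → ℕ
ones []           = 0
ones (true  ∷ bs) = suc (ones bs)
ones (false ∷ bs) = ones bs

allVecs : {A : Set} → List A → (k : ℕ) → List (Vec A k)
allVecs xs zero    = [] ∷ []
allVecs xs (suc k) = concatMap (λ x → map (x ∷_) (allVecs xs k)) xs

allSubsets : (n : ℕ) → List (Subset n)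
allSubsets n = allVecs (true ∷ false ∷ []) n

maximum : List ℕ → ℕ
maximum = foldr _⊔_ 0

sumℚ : List ℚ → ℚ
sumℚ = foldr _+_ 0ℚ

-- (0,1)-sequences of length n with exactly r ones.
-- A sequence r̲ = (r_1,…,r_n) is a `Vec Bool n` (true = 1, false = 0).

Seq : ℕ → Set
Seq n = Vec Bool n

HasOnes : {n : ℕ} → ℕ → Seq n → Set
HasOnes r s = ones (toList s) ≡ r

seqs : (n r : ℕ) → List (Seq n)
seqs n r = filter (λ s → ones (toList s) Data.Nat.≟ r) (allSubsets n)

-- Matroids are given by their rank functions  Subset n → ℕ.

IsPerm : {n : ℕ} → Vec (Fin n) n → Set
IsPerm π = Unique (toList π)

perms : (n : ℕ) → List (Vec (Fin n) n)
perms n = filter (λ π → UD.unique? _≟F_ (toList π)) (allVecs (allFin n) n)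

prefixSet : {n : ℕ} → Vec (Fin n) n → ℕ → Subset n
prefixSet π j = foldr (λ i S → ⁅ i ⁆ ∪ S) ⊥ (take j (toList π))

-- rank sequence r̲(π): r_j = r({π(1..j)}) - r({π(1..j-1)})  (j = 1..n)
-- (this is r({π(1)}) for j = 1 since r(∅) = 0 for a matroid)
rankSeq : {n : ℕ} → (Subset n → ℕ) → Vec (Fin n) n → Vec ℕ n
rankSeq rk π = tabulate (λ j → rk (prefixSet π (suc (toℕ j))) ∸ rk (prefixSet π (toℕ j)))

boolToℕ : Bool → ℕ
boolToℕ true  = 1
boolToℕ false = 0

-- The 𝒢-invariant 𝒢(M) = Σ_π [r̲(π)] ∈ 𝒢(n,r).  Since the symbols [r̲] are
-- linearly independent, 𝒢(M) is identified with its coefficient vector: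
-- the coefficient of [s] is the number of permutations π with r̲(π) = s.
GInv : {n : ℕ} → (Subset n → ℕ) → Seq n → ℕ
GInv {n} rk s =
  length (filter (λ π → ≡-dec Data.Nat._≟_ (rankSeq rk π) (Data.Vec.map boolToℕ s)) (perms n))

FreedomIndep : {n : ℕ} → Seq n → Subset n → Set
FreedomIndep {n} s S =
  (i : Fin (suc n)) → ones (take (toℕ i) (toList S)) ≤ ones (take (toℕ i) (toList s))

freedomIndep? : {n : ℕ} (s : Seq n) (S : Subset n) → Dec (FreedomIndep s S)
freedomIndep? s S = all? (λ i → _ ≤? _)

freedomRank : {n : ℕ} → Seq n → Subset n → ℕ
freedomRank {n} s X =
  maximum (map ∣_∣ (filter (λ S → freedomIndep? s S) (filter (λ S → S ⊆? X) (allSubsets n))))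

-- The vector space 𝒢(n,r): elements are coefficient vectors
-- v : Seq n → ℚ (only values on sequences with r ones are relevant).

linComb : (n r : ℕ) → (Seq n → ℚ) → Seq n → ℚ
linComb n r c s = sumℚ (map (λ t → c t * (ℤ.+ GInv (freedomRank t) s / 1)) (seqs n r))

module Submission where

-- The matrix expressing the 𝒢-invariants of the freedom matroids in the
-- basis of symbols of 𝒢(n,r) is triangular with nonzero diagonal.
--
-- Write M s t for the coefficient of [s] in 𝒢(F(t)), i.e. the number of
-- permutations whose rank sequence in F(t) is s.  Two facts about the freedom
-- matroid drive the proof:
--   * a set of size k has rank ≥ t₁ + ⋯ + t_k in F(t), with equality for the
--     initial segment {1,…,k};
--   * hence if M s t ≠ 0 then, along a witnessing permutation, every prefix
--     sum of t is at most the corresponding prefix sum of s (s dominates t),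
--     while the identity permutation shows M t t ≠ 0.
-- Dominance strictly lowers the weight Σᵢ (s₁ + ⋯ + sᵢ), so M is triangular
-- with respect to this weight.

open import Defs
open import Data.Bool using (Bool; true; false)
open import Data.Nat as ℕ using (ℕ; zero; suc; _<_)
import Data.Nat.Properties as ℕ
open import Data.Nat.ListAction using (sum)
open import Data.List as List using (List; []; _∷_; map; filter; length; take; upTo)
open import Data.List.Membership.Propositional using (_∈_)
open import Data.List.Membership.Propositional.Properties
  using (∈-map⁺; ∈-map⁻; ∈-filter⁺; ∈-filter⁻; ∈-concatMap⁺; ∈-allFin; ∈-upTo⁺; ∈-upTo⁻)
import Data.List.Relation.Unary.Any as Any
open Any using (here; there)
import Data.List.Relation.Unary.All as All
open import Data.List.Relation.Unary.Unique.Propositional using (Unique)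
import Data.List.Relation.Unary.Unique.Propositional.Properties as Unique
open import Data.List.Relation.Unary.AllPairs using ([]; _∷_)
import Data.List.Properties as List
open import Data.Vec as Vec using (Vec; []; _∷_; toList; lookup; tabulate; _[_]=_)
open _[_]=_ renaming (here to hereₛ; there to thereₛ)
import Data.Vec.Properties as Vec
open import Data.Fin using (Fin; toℕ; fromℕ<) renaming (zero to fzero; suc to fsuc)
import Data.Fin.Properties as Fin
open import Data.Fin.Subset using (Subset; _⊆_; ∣_∣; ⁅_⁆; _∪_) renaming (_∈_ to _∈ₛ_; ⊥ to ∅)
import Data.Fin.Subset.Properties as Subset
open import Data.Fin.Subset.Properties using (_⊆?_)
open import Data.Product using (Σ; ∃; _×_; _,_; proj₁; proj₂)
open import Data.Sum using (inj₁; inj₂)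
open import Relation.Nullary using (Dec; yes; no; ¬_)
open import Relation.Binary.PropositionalEquality
open import Data.Empty using (⊥-elim)
open import Function using (id; _∘_)

module TriangularSystems where

  open import Data.Rational using (ℚ; 0ℚ; _+_; _*_; _-_; -_; 1/_; ≢-nonZero)
  open import Data.Rational.Properties
    using (_≟_; +-assoc; +-comm; +-identityˡ; +-identityʳ; +-inverseʳ; *-zeroˡ; *-zeroʳ;
           *-assoc; *-identityʳ; *-inverseˡ; *-inverseʳ; *-distribʳ-+; neg-distribˡ-*)

  Σℚ : {A : Set} → List A → (A → ℚ) → ℚ
  Σℚ L f = sumℚ (map f L)

  Σ-cong : {A : Set} (L : List A) {f g : A → ℚ} → (∀ {x} → x ∈ L → f x ≡ g x) → Σℚ L f ≡ Σℚ L g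
  Σ-cong []      eq = refl
  Σ-cong (x ∷ L) eq = cong₂ _+_ (eq (here refl)) (Σ-cong L (eq ∘ there))

  Σ-+ : {A : Set} (L : List A) (f g : A → ℚ) → Σℚ L (λ x → f x + g x) ≡ Σℚ L f + Σℚ L g
  Σ-+ []      f g = sym (+-identityˡ 0ℚ)
  Σ-+ (x ∷ L) f g = trans (cong (f x + g x +_) (Σ-+ L f g)) (interchange (f x) (g x) _ _)
    where
    interchange : ∀ a b c d → (a + b) + (c + d) ≡ (a + c) + (b + d)
    interchange a b c d = begin
      (a + b) + (c + d) ≡⟨ +-assoc a b (c + d) ⟩
      a + (b + (c + d)) ≡⟨ cong (a +_) (+-assoc b c d) ⟨
      a + ((b + c) + d) ≡⟨ cong (λ z → a + (z + d)) (+-comm b c) ⟩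
      a + ((c + b) + d) ≡⟨ cong (a +_) (+-assoc c b d) ⟩
      a + (c + (b + d)) ≡⟨ +-assoc a c (b + d) ⟨
      (a + c) + (b + d) ∎
      where open ≡-Reasoning

  Σ-zero : {A : Set} (L : List A) {f : A → ℚ} → (∀ {x} → x ∈ L → f x ≡ 0ℚ) → Σℚ L f ≡ 0ℚ
  Σ-zero []      f≡0 = refl
  Σ-zero (x ∷ L) f≡0 = trans (cong₂ _+_ (f≡0 (here refl)) (Σ-zero L (f≡0 ∘ there))) (+-identityˡ 0ℚ)

  Σ-single : {A : Set} (L : List A) (f : A → ℚ) {s : A} → Unique L → s ∈ L →
             (∀ {x} → x ∈ L → x ≢ s → f x ≡ 0ℚ) → Σℚ L f ≡ f s
  Σ-single (x ∷ L) f (x∉L ∷ _) (here refl) others =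
    trans (cong (f x +_) (Σ-zero L (λ m → others (there m) (λ { refl → All.lookup x∉L m refl }))))
          (+-identityʳ (f x))
  Σ-single (x ∷ L) f (x∉L ∷ u) (there s∈L) others =
    trans (cong₂ _+_ (others (here refl) (λ { refl → All.lookup x∉L s∈L refl })) (Σ-single L f u s∈L (others ∘ there)))
          (+-identityˡ _)

  p+[q-p]≡q : ∀ p q → p + (q - p) ≡ q
  p+[q-p]≡q p q = begin
    p + (q - p)   ≡⟨ cong (p +_) (+-comm q (- p)) ⟩
    p + (- p + q) ≡⟨ +-assoc p (- p) q ⟨
    (p + - p) + q ≡⟨ cong (_+ q) (+-inverseʳ p) ⟩
    0ℚ + q        ≡⟨ +-identityˡ q ⟩
    q             ∎
    where open ≡-Reasoning

  -- Total division: p ÷ 0 is 0.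
  _÷_ : ℚ → ℚ → ℚ
  p ÷ q with q ≟ 0ℚ
  ... | yes _   = 0ℚ
  ... | no q≢0 = p * (1/ q) {{≢-nonZero q≢0}}

  ÷-* : ∀ p {q} → q ≢ 0ℚ → (p ÷ q) * q ≡ p
  ÷-* p {q} q≢0 with q ≟ 0ℚ
  ... | yes q≡0 = ⊥-elim (q≢0 q≡0)
  ... | no q≢0′ = trans (*-assoc p _ q) (trans (cong (p *_) (*-inverseˡ q {{≢-nonZero q≢0′}})) (*-identityʳ p))

  *-÷ : ∀ p {q} → q ≢ 0ℚ → (p * q) ÷ q ≡ p
  *-÷ p {q} q≢0 with q ≟ 0ℚ
  ... | yes q≡0 = ⊥-elim (q≢0 q≡0)
  ... | no q≢0′ = trans (*-assoc p q _) (trans (cong (p *_) (*-inverseʳ q {{≢-nonZero q≢0′}})) (*-identityʳ p))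

  *-cancel-nonzero : ∀ p {q} → q ≢ 0ℚ → p * q ≡ 0ℚ → p ≡ 0ℚ
  *-cancel-nonzero p {q} q≢0 pq≡0 = trans (sym (*-÷ p q≢0)) (trans (cong (_÷ q) pq≡0) (0÷ q))
    where
    0÷ : ∀ q → 0ℚ ÷ q ≡ 0ℚ
    0÷ q with q ≟ 0ℚ
    ... | yes _ = refl
    ... | no q≢0 = *-zeroˡ ((1/ q) {{≢-nonZero q≢0}})

  module Triangular {A : Set} (L : List A) (L-unique : Unique L) (w : A → ℕ) (M : A → A → ℚ)
    (triangular : ∀ {s t} → s ∈ L → t ∈ L → t ≢ s → M s t ≢ 0ℚ → w t < w s)
    (diagonal : ∀ {s} → s ∈ L → M s s ≢ 0ℚ) where

    apply : (A → ℚ) → A → ℚ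
    apply c s = Σℚ L (λ t → c t * M s t)

    apply-diagonal : (c : A → ℚ) {s : A} → s ∈ L → (∀ {t} → t ∈ L → w t < w s → c t ≡ 0ℚ) →
                     apply c s ≡ c s * M s s
    apply-diagonal c {s} s∈L lighter = Σ-single L _ L-unique s∈L off-diagonal
      where
      off-diagonal : ∀ {t} → t ∈ L → t ≢ s → c t * M s t ≡ 0ℚ
      off-diagonal {t} t∈L t≢s with M s t ≟ 0ℚ
      ... | yes Mst≡0 = trans (cong (c t *_) Mst≡0) (*-zeroʳ (c t))
      ... | no Mst≢0  = trans (cong (_* M s t) (lighter t∈L (triangular s∈L t∈L t≢s Mst≢0))) (*-zeroˡ (M s t))

    independent : (c : A → ℚ) → (∀ {s} → s ∈ L → apply c s ≡ 0ℚ) → ∀ {t} → t ∈ L → c t ≡ 0ℚ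
    independent c c↦0 {t} t∈L = lighter-than (suc (w t)) t∈L ℕ.≤-refl
      where
      lighter-than : ∀ k {t} → t ∈ L → w t < k → c t ≡ 0ℚ
      lighter-than (suc k) {t} t∈L wt<1+k = *-cancel-nonzero (c t) (diagonal t∈L) (begin
        c t * M t t ≡⟨ sym (apply-diagonal c t∈L (λ u∈L wu<wt → lighter-than k u∈L (ℕ.<-≤-trans wu<wt (ℕ.≤-pred wt<1+k)))) ⟩
        apply c t   ≡⟨ c↦0 t∈L ⟩
        0ℚ          ∎)
        where open ≡-Reasoning

    -- Back substitution: approx k has solved for the coefficients of weight < k
    -- (and is 0 elsewhere); the coefficients of weight k are then read off the
    -- rows of weight k.
    module BackSubstitution (v : A → ℚ) where

      approx : ℕ → A → ℚ
      approx zero    s = 0ℚ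
      approx (suc k) s with w s ℕ.≟ k
      ... | yes _ = (v s - apply (approx k) s) ÷ M s s
      ... | no _  = approx k s

      -- a coefficient is final once its own weight has been processed
      solution : A → ℚ
      solution s = approx (suc (w s)) s

      approx-step : ∀ k s → w s ≡ k → approx (suc k) s ≡ (v s - apply (approx k) s) ÷ M s s
      approx-step k s ws≡k with w s ℕ.≟ k
      ... | yes _    = refl
      ... | no ws≢k = ⊥-elim (ws≢k ws≡k)

      approx-skip : ∀ k s → w s ≢ k → approx (suc k) s ≡ approx k s
      approx-skip k s ws≢k with w s ℕ.≟ k
      ... | yes ws≡k = ⊥-elim (ws≢k ws≡k)
      ... | no _     = refl

      approx-heavy : ∀ k s → k ℕ.≤ w s → approx k s ≡ 0ℚ
      approx-heavy zero    s _    = refl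
      approx-heavy (suc k) s k<ws =
        trans (approx-skip k s (λ ws≡k → ℕ.<-irrefl (sym ws≡k) k<ws)) (approx-heavy k s (ℕ.<⇒≤ k<ws))

      approx-settled : ∀ k s → w s < k → approx k s ≡ solution s
      approx-settled (suc k) s ws<1+k with ℕ.m≤n⇒m<n∨m≡n (ℕ.≤-pred ws<1+k)
      ... | inj₁ ws<k = trans (approx-skip k s (ℕ.<⇒≢ ws<k)) (approx-settled k s ws<k)
      ... | inj₂ refl = refl

      -- Row s: the coefficients lighter than s already agree with approx (w s),
      -- so the correction solution - approx (w s) only contributes its diagonal term.
      solves : ∀ {s} → s ∈ L → apply solution s ≡ v s
      solves {s} s∈L = begin
        apply solution s                        ≡⟨ Σ-cong L (λ {t} _ → split (solution t) (approx k t) (M s t)) ⟩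
        Σℚ L (λ t → approx k t * M s t + δ t * M s t) ≡⟨ Σ-+ L _ _ ⟩
        a + apply δ s                           ≡⟨ cong (a +_) (apply-diagonal δ s∈L δ-lighter) ⟩
        a + (solution s - approx k s) * M s s   ≡⟨ cong (λ z → a + (solution s - z) * M s s) (approx-heavy k s ℕ.≤-refl) ⟩
        a + (solution s - 0ℚ) * M s s           ≡⟨ cong (λ z → a + z * M s s) (+-identityʳ (solution s)) ⟩
        a + solution s * M s s                  ≡⟨ cong (λ z → a + z * M s s) (approx-step k s refl) ⟩
        a + ((v s - a) ÷ M s s) * M s s         ≡⟨ cong (a +_) (÷-* (v s - a) (diagonal s∈L)) ⟩
        a + (v s - a)                           ≡⟨ p+[q-p]≡q a (v s) ⟩
        v s                                     ∎
        where
        open ≡-Reasoning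
        k = w s
        a = apply (approx k) s
        δ : A → ℚ
        δ t = solution t - approx k t
        δ-lighter : ∀ {t} → t ∈ L → w t < w s → δ t ≡ 0ℚ
        δ-lighter {t} _ wt<ws = trans (cong (λ z → solution t - z) (approx-settled k t wt<ws)) (+-inverseʳ (solution t))
        split : ∀ x y m → x * m ≡ y * m + (x - y) * m
        split x y m = begin
          x * m                         ≡⟨ p+[q-p]≡q (y * m) (x * m) ⟨
          y * m + (x * m - y * m)       ≡⟨ cong (λ z → y * m + (x * m + z)) (neg-distribˡ-* y m) ⟩
          y * m + (x * m + (- y) * m)   ≡⟨ cong (y * m +_) (*-distribʳ-+ m x (- y)) ⟨
          y * m + (x - y) * m           ∎

    spanning : (v : A → ℚ) → Σ (A → ℚ) (λ c → ∀ {s} → s ∈ L → apply c s ≡ v s)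
    spanning v = solution , solves
      where open BackSubstitution v

-- From here on arithmetic is in ℕ (the ℚ operators are local to TriangularSystems).
open import Data.Nat using (_+_; _∸_; _≤_; z≤n; s≤s)

allVecs-complete : {A : Set} (xs : List A) → (∀ x → x ∈ xs) → ∀ k (v : Vec A k) → v ∈ allVecs xs k
allVecs-complete xs every zero    []      = here refl
allVecs-complete xs every (suc k) (x ∷ v) =
  ∈-concatMap⁺ _ (Any.map (λ { refl → ∈-map⁺ (x ∷_) (allVecs-complete xs every k v) }) (every x))

allSubsets-complete : ∀ n (S : Subset n) → S ∈ allSubsets n
allSubsets-complete n = allVecs-complete _ every-bool n
  where
  every-bool : ∀ b → b ∈ true ∷ false ∷ []
  every-bool true  = here refl
  every-bool false = there (here refl)

-- allSubsets has no repetitions: the two halves differ in the first letter.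
allSubsets-unique : ∀ n → Unique (allSubsets n)
allSubsets-unique zero    = All.[] ∷ []
allSubsets-unique (suc n) =
  Unique.++⁺ (Unique.map⁺ Vec.∷-injectiveʳ (allSubsets-unique n))
             (Unique.++⁺ (Unique.map⁺ Vec.∷-injectiveʳ (allSubsets-unique n)) [] (λ ()))
             heads-differ
  where
  heads-differ : ∀ {S} → ¬ (S ∈ map (true ∷_) (allSubsets n) × S ∈ List._++_ (map (false ∷_) (allSubsets n)) [])
  heads-differ (S∈₁ , S∈₂) with ∈-map⁻ (true ∷_) S∈₁
                             | ∈-map⁻ (false ∷_) (subst (_ ∈_) (List.++-identityʳ _) S∈₂)
  ... | _ , _ , refl | _ , _ , ()

seqs-unique : ∀ n r → Unique (seqs n r)
seqs-unique n r = Unique.filter⁺ _ (allSubsets-unique n)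

seqs-complete : ∀ n r {s : Seq n} → HasOnes r s → s ∈ seqs n r
seqs-complete n r {s} = ∈-filter⁺ _ (allSubsets-complete n s)

seqs-sound : ∀ n r {s : Seq n} → s ∈ seqs n r → HasOnes r s
seqs-sound n r = proj₂ ∘ ∈-filter⁻ _ {xs = allSubsets n}

perms-unique : ∀ {n} {π : Vec (Fin n) n} → π ∈ perms n → IsPerm π
perms-unique {n} = proj₂ ∘ ∈-filter⁻ _ {xs = allVecs (List.allFin n) n}

perms-complete : ∀ {n} {π : Vec (Fin n) n} → IsPerm π → π ∈ perms n
perms-complete {n} {π} = ∈-filter⁺ _ (allVecs-complete _ ∈-allFin n π)

filter-witness : {A : Set} {P : A → Set} (P? : ∀ x → Dec (P x)) (L : List A) →
                 length (filter P? L) ≢ 0 → ∃ λ x → x ∈ L × P x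
filter-witness P? L ne with filter P? L in eq
... | []    = ⊥-elim (ne refl)
... | y ∷ _ = y , ∈-filter⁻ P? (subst (y ∈_) (sym eq) (here refl))

filter-nonempty : {A : Set} {P : A → Set} (P? : ∀ x → Dec (P x)) {L : List A} {x : A} →
                  x ∈ L → P x → length (filter P? L) ≢ 0
filter-nonempty P? {L} x∈L px len≡0 with filter P? L | ∈-filter⁺ P? x∈L px
... | [] | ()

prefixSum : ℕ → List Bool → ℕ
prefixSum i l = ones (take i l)

ones-∷ : ∀ b l → ones (b ∷ l) ≡ boolToℕ b + ones l
ones-∷ true  l = refl
ones-∷ false l = refl

prefixSum-≤-suc : ∀ i l → prefixSum i l ≤ prefixSum (suc i) l
prefixSum-≤-suc zero    l           = z≤n
prefixSum-≤-suc (suc i) []          = z≤n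
prefixSum-≤-suc (suc i) (true ∷ l)  = s≤s (prefixSum-≤-suc i l)
prefixSum-≤-suc (suc i) (false ∷ l) = prefixSum-≤-suc i l

prefixSum-[] : ∀ i → prefixSum i [] ≡ 0
prefixSum-[] i = cong ones (List.take-[] i)

prefixSum-lookup : ∀ {n} (s : Vec Bool n) (j : Fin n) →
                   prefixSum (suc (toℕ j)) (toList s) ≡ prefixSum (toℕ j) (toList s) + boolToℕ (lookup s j)
prefixSum-lookup (b ∷ s) fzero    = trans (ones-∷ b []) (ℕ.+-comm (boolToℕ b) 0)
prefixSum-lookup (b ∷ s) (fsuc j) = begin
  ones (b ∷ take (suc (toℕ j)) (toList s))        ≡⟨ ones-∷ b _ ⟩
  boolToℕ b + prefixSum (suc (toℕ j)) (toList s)   ≡⟨ cong (boolToℕ b +_) (prefixSum-lookup s j) ⟩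
  boolToℕ b + (prefixSum (toℕ j) (toList s) + x)   ≡⟨ ℕ.+-assoc (boolToℕ b) _ x ⟨
  boolToℕ b + prefixSum (toℕ j) (toList s) + x     ≡⟨ cong (_+ x) (ones-∷ b _) ⟨
  ones (b ∷ take (toℕ j) (toList s)) + x           ∎
  where
  open ≡-Reasoning
  x = boolToℕ (lookup s j)

ones-singleton-injective : ∀ {a b} → ones (a ∷ []) ≡ ones (b ∷ []) → a ≡ b
ones-singleton-injective {true}  {true}  _ = refl
ones-singleton-injective {false} {false} _ = refl

prefixSum-injective : ∀ {n} (s t : Seq n) →
                      (∀ i → i ≤ n → prefixSum i (toList s) ≡ prefixSum i (toList t)) → s ≡ t
prefixSum-injective []      []      same = refl
prefixSum-injective (a ∷ s) (b ∷ t) same = cong₂ _∷_ a≡b (prefixSum-injective s t same-tail)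
  where
  a≡b : a ≡ b
  a≡b = ones-singleton-injective (same 1 (s≤s z≤n))
  same-tail : ∀ i → i ≤ _ → prefixSum i (toList s) ≡ prefixSum i (toList t)
  same-tail i i≤n = ℕ.+-cancelˡ-≡ (boolToℕ a) _ _ (begin
    boolToℕ a + prefixSum i (toList s)  ≡⟨ ones-∷ a _ ⟨
    prefixSum (suc i) (toList (a ∷ s))  ≡⟨ same (suc i) (s≤s i≤n) ⟩
    prefixSum (suc i) (toList (b ∷ t))  ≡⟨ ones-∷ b _ ⟩
    boolToℕ b + prefixSum i (toList t)  ≡⟨ cong (λ c → boolToℕ c + prefixSum i (toList t)) a≡b ⟨
    boolToℕ a + prefixSum i (toList t)  ∎)
    where open ≡-Reasoning

≤-maximum : ∀ {x} (L : List ℕ) → x ∈ L → x ≤ maximum L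
≤-maximum (y ∷ L) (here refl) = ℕ.m≤m⊔n y _
≤-maximum (y ∷ L) (there x∈L) = ℕ.≤-trans (≤-maximum L x∈L) (ℕ.m≤n⊔m y _)

maximum-≤ : ∀ {b} (L : List ℕ) → (∀ {x} → x ∈ L → x ≤ b) → maximum L ≤ b
maximum-≤ []      bound = z≤n
maximum-≤ (y ∷ L) bound = ℕ.⊔-lub (bound (here refl)) (maximum-≤ L (bound ∘ there))

rank-≥ : ∀ {n} (t : Seq n) {X S : Subset n} → S ⊆ X → FreedomIndep t S → ∣ S ∣ ≤ freedomRank t X
rank-≥ {n} t {X} {S} S⊆X indep =
  ≤-maximum _ (∈-map⁺ ∣_∣ (∈-filter⁺ (freedomIndep? t) (∈-filter⁺ (_⊆? X) (allSubsets-complete n S) S⊆X) indep))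

rank-≤ : ∀ {n} (t : Seq n) (X : Subset n) {b : ℕ} →
         (∀ {S} → S ⊆ X → FreedomIndep t S → ∣ S ∣ ≤ b) → freedomRank t X ≤ b
rank-≤ {n} t X {b} bound = maximum-≤ _ candidate-≤
  where
  candidate-≤ : ∀ {x} → x ∈ map ∣_∣ (filter (freedomIndep? t) (filter (_⊆? X) (allSubsets n))) → x ≤ b
  candidate-≤ x∈ with ∈-map⁻ ∣_∣ x∈
  ... | S , S∈ , refl with ∈-filter⁻ (freedomIndep? t) {xs = filter (_⊆? X) (allSubsets n)} S∈
  ... | S∈′ , indep = bound (proj₂ (∈-filter⁻ (_⊆? X) {xs = allSubsets n} S∈′)) indep

select : ∀ {n} → Subset n → List Bool → Subset n
select []          p       = []
select (false ∷ X) p       = false ∷ select X p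
select (true  ∷ X) []      = false ∷ select X []
select (true  ∷ X) (b ∷ p) = b ∷ select X p

select-⊆ : ∀ {n} (X : Subset n) (p : List Bool) → select X p ⊆ X
select-⊆ (false ∷ X) p       (thereₛ x∈) = thereₛ (select-⊆ X p x∈)
select-⊆ (true  ∷ X) []      (thereₛ x∈) = thereₛ (select-⊆ X [] x∈)
select-⊆ (true  ∷ X) (b ∷ p) hereₛ = hereₛ
select-⊆ (true  ∷ X) (b ∷ p) (thereₛ x∈) = thereₛ (select-⊆ X p x∈)

select-size : ∀ {n} (X : Subset n) (p : List Bool) → ∣ select X p ∣ ≡ prefixSum ∣ X ∣ p
select-size []          p           = refl
select-size (false ∷ X) p           = select-size X p
select-size (true  ∷ X) []          = trans (select-size X []) (prefixSum-[] ∣ X ∣)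
select-size (true  ∷ X) (true  ∷ p) = cong suc (select-size X p)
select-size (true  ∷ X) (false ∷ p) = select-size X p

-- The j-th element of X is at position ≥ j, so the selected set never has
-- more ones among its first i positions than p does.
select-prefixSum : ∀ {n} (X : Subset n) (p : List Bool) i → prefixSum i (toList (select X p)) ≤ prefixSum i p
select-prefixSum X           p           zero    = z≤n
select-prefixSum []          p           (suc i) = z≤n
select-prefixSum (false ∷ X) p           (suc i) = ℕ.≤-trans (select-prefixSum X p i) (prefixSum-≤-suc i p)
select-prefixSum (true  ∷ X) []          (suc i) = ℕ.≤-trans (select-prefixSum X [] i) (ℕ.≤-reflexive (prefixSum-[] i))
select-prefixSum (true  ∷ X) (true  ∷ p) (suc i) = s≤s (select-prefixSum X p i)
select-prefixSum (true  ∷ X) (false ∷ p) (suc i) = select-prefixSum X p i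

rank-lower-bound : ∀ {n} (t : Seq n) (X : Subset n) → prefixSum ∣ X ∣ (toList t) ≤ freedomRank t X
rank-lower-bound t X = begin
  prefixSum ∣ X ∣ (toList t) ≡⟨ select-size X (toList t) ⟨
  ∣ select X (toList t) ∣    ≤⟨ rank-≥ t (select-⊆ X (toList t)) (λ i → select-prefixSum X (toList t) (toℕ i)) ⟩
  freedomRank t X           ∎
  where open ℕ.≤-Reasoning

setOf : ∀ {n} → List (Fin n) → Subset n
setOf = List.foldr (λ i S → ⁅ i ⁆ ∪ S) ∅

setOf-⊆ : ∀ {n} (l : List (Fin n)) {x} → x ∈ₛ setOf l → x ∈ l
setOf-⊆ []      x∈ = ⊥-elim (Subset.∉⊥ x∈)
setOf-⊆ (i ∷ l) x∈ with Subset.x∈p∪q⁻ ⁅ i ⁆ (setOf l) x∈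
... | inj₁ x∈⁅i⁆ = here (Subset.x∈⁅y⁆⇒x≡y i x∈⁅i⁆)
... | inj₂ x∈l   = there (setOf-⊆ l x∈l)

∣⁅x⁆∪S∣ : ∀ {n} (x : Fin n) (S : Subset n) → ¬ (x ∈ₛ S) → ∣ ⁅ x ⁆ ∪ S ∣ ≡ suc ∣ S ∣
∣⁅x⁆∪S∣ fzero    (true  ∷ S) x∉S = ⊥-elim (x∉S hereₛ)
∣⁅x⁆∪S∣ fzero    (false ∷ S) x∉S = cong (suc ∘ ∣_∣) (Subset.∪-identityˡ S)
∣⁅x⁆∪S∣ (fsuc x) (true  ∷ S) x∉S = cong suc (∣⁅x⁆∪S∣ x S (x∉S ∘ thereₛ))
∣⁅x⁆∪S∣ (fsuc x) (false ∷ S) x∉S = ∣⁅x⁆∪S∣ x S (x∉S ∘ thereₛ)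

∣setOf∣ : ∀ {n} (l : List (Fin n)) → Unique l → ∣ setOf l ∣ ≡ length l
∣setOf∣ {n} []      _           = Subset.∣⊥∣≡0 n
∣setOf∣     (i ∷ l) (i∉l ∷ u) =
  trans (∣⁅x⁆∪S∣ i (setOf l) (λ i∈ → All.lookup i∉l (setOf-⊆ l i∈) refl)) (cong suc (∣setOf∣ l u))

∣prefixSet∣ : ∀ {n} (π : Vec (Fin n) n) → IsPerm π → ∀ i → i ≤ n → ∣ prefixSet π i ∣ ≡ i
∣prefixSet∣ {n} π perm i i≤n = begin
  ∣ prefixSet π i ∣           ≡⟨ ∣setOf∣ (take i (toList π)) (Unique.take⁺ i perm) ⟩
  length (take i (toList π))  ≡⟨ List.length-take i (toList π) ⟩
  i ℕ.⊓ length (toList π)      ≡⟨ cong (i ℕ.⊓_) (Vec.length-toList π) ⟩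
  i ℕ.⊓ n                      ≡⟨ ℕ.m≤n⇒m⊓n≡m i≤n ⟩
  i                            ∎
  where open ≡-Reasoning

identity : ∀ n → Vec (Fin n) n
identity n = Vec.allFin n

toList-tabulate : ∀ {A : Set} {n} (f : Fin n → A) → toList (tabulate f) ≡ List.tabulate f
toList-tabulate {n = zero}  f = refl
toList-tabulate {n = suc n} f = cong (f fzero ∷_) (toList-tabulate (f ∘ fsuc))

identity-isPerm : ∀ n → IsPerm (identity n)
identity-isPerm n = subst Unique (sym (toList-tabulate id)) (Unique.allFin⁺ n)

∈-take-tabulate : ∀ {A : Set} {n} (f : Fin n → A) k {x} →
                  x ∈ take k (List.tabulate f) → ∃ λ j → toℕ j < k × x ≡ f j
∈-take-tabulate {n = suc n} f (suc k) (here refl) = fzero , s≤s z≤n , refl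
∈-take-tabulate {n = suc n} f (suc k) (there x∈) with ∈-take-tabulate (f ∘ fsuc) k x∈
... | j , j<k , refl = fsuc j , s≤s j<k , refl

initialSegment-< : ∀ {n} k {x} → x ∈ₛ prefixSet (identity n) k → toℕ x < k
initialSegment-< {n} k x∈ with ∈-take-tabulate id k (subst (λ l → _ ∈ take k l) (toList-tabulate id) (setOf-⊆ _ x∈))
... | _ , j<k , refl = j<k

∣∣-≤-prefixSum : ∀ {n} (S : Subset n) k → (∀ {x} → x ∈ₛ S → toℕ x < k) → ∣ S ∣ ≤ prefixSum k (toList S)
∣∣-≤-prefixSum []          k       below = z≤n
∣∣-≤-prefixSum (true  ∷ S) zero    below = ⊥-elim (ℕ.n≮0 (below hereₛ))
∣∣-≤-prefixSum (false ∷ S) zero    below = ∣∣-≤-prefixSum S zero (λ x∈ → ⊥-elim (ℕ.n≮0 (below (thereₛ x∈))))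
∣∣-≤-prefixSum (true  ∷ S) (suc k) below = s≤s (∣∣-≤-prefixSum S k (ℕ.≤-pred ∘ below ∘ thereₛ))
∣∣-≤-prefixSum (false ∷ S) (suc k) below = ∣∣-≤-prefixSum S k (ℕ.≤-pred ∘ below ∘ thereₛ)

rank-initialSegment : ∀ {n} (t : Seq n) k → k ≤ n → freedomRank t (prefixSet (identity n) k) ≡ prefixSum k (toList t)
rank-initialSegment {n} t k k≤n = ℕ.≤-antisym (rank-≤ t X upper) lower
  where
  X = prefixSet (identity n) k
  upper : ∀ {S} → S ⊆ X → FreedomIndep t S → ∣ S ∣ ≤ prefixSum k (toList t)
  upper {S} S⊆X indep = ℕ.≤-trans (∣∣-≤-prefixSum S k (initialSegment-< k ∘ S⊆X))
    (subst (λ i → prefixSum i (toList S) ≤ prefixSum i (toList t)) (Fin.toℕ-fromℕ< (s≤s k≤n)) (indep (fromℕ< (s≤s k≤n))))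
  lower : prefixSum k (toList t) ≤ freedomRank t X
  lower = subst (λ i → prefixSum i (toList t) ≤ freedomRank t X)
                (∣prefixSet∣ (identity n) (identity-isPerm n) k k≤n) (rank-lower-bound t X)

telescope : ∀ {n} (s : Seq n) (h : ℕ → ℕ) → (∀ j → boolToℕ (lookup s j) ≡ h (suc (toℕ j)) ∸ h (toℕ j)) →
            ∀ i → i ≤ n → h i ≤ h 0 + prefixSum i (toList s)
telescope s       h increments zero    _         = ℕ.m≤m+n (h 0) 0
telescope (b ∷ s) h increments (suc i) (s≤s i≤n) = begin
  h (suc i)                             ≤⟨ telescope s (h ∘ suc) (increments ∘ fsuc) i i≤n ⟩
  h 1 + prefixSum i (toList s)          ≤⟨ ℕ.+-monoˡ-≤ _ first-step ⟩
  h 0 + boolToℕ b + prefixSum i (toList s)   ≡⟨ ℕ.+-assoc (h 0) (boolToℕ b) _ ⟩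
  h 0 + (boolToℕ b + prefixSum i (toList s)) ≡⟨ cong (h 0 +_) (ones-∷ b _) ⟨
  h 0 + prefixSum (suc i) (toList (b ∷ s))   ∎
  where
  open ℕ.≤-Reasoning
  first-step : h 1 ≤ h 0 + boolToℕ b
  first-step = ℕ.≤-trans (ℕ.m≤n+m∸n (h 1) (h 0)) (ℕ.≤-reflexive (cong (h 0 +_) (sym (increments fzero))))

rankSeq-is? : ∀ {n} (rk : Subset n → ℕ) (s : Seq n) (π : Vec (Fin n) n) → Dec (rankSeq rk π ≡ Vec.map boolToℕ s)
rankSeq-is? rk s π = Vec.≡-dec ℕ._≟_ (rankSeq rk π) (Vec.map boolToℕ s)

-- If [s] occurs in 𝒢(F(t)) then s dominates t: every prefix sum of t is at
-- most the corresponding prefix sum of s.  (Along a witnessing permutation π,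
-- the i-th prefix set has rank ≥ t₁+⋯+tᵢ by size and ≤ s₁+⋯+sᵢ by telescoping.)
dominated : ∀ {n} (s t : Seq n) → GInv (freedomRank t) s ≢ 0 →
            ∀ i → i ≤ n → prefixSum i (toList t) ≤ prefixSum i (toList s)
dominated {n} s t occurs i i≤n
  with filter-witness (rankSeq-is? (freedomRank t) s) (perms n) occurs
... | π , π∈perms , π-rankSeq = begin
  prefixSum i (toList t)                 ≡⟨ cong (λ k → prefixSum k (toList t)) (∣prefixSet∣ π (perms-unique π∈perms) i i≤n) ⟨
  prefixSum ∣ prefixSet π i ∣ (toList t) ≤⟨ rank-lower-bound t (prefixSet π i) ⟩
  h i                                    ≤⟨ telescope s h increments i i≤n ⟩
  h 0 + prefixSum i (toList s)           ≡⟨ cong (_+ prefixSum i (toList s)) (rank-initialSegment t 0 z≤n) ⟩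
  prefixSum i (toList s)                 ∎
  where
  open ℕ.≤-Reasoning
  h : ℕ → ℕ
  h j = freedomRank t (prefixSet π j)
  increments : ∀ j → boolToℕ (lookup s j) ≡ h (suc (toℕ j)) ∸ h (toℕ j)
  increments j = begin-equality
    boolToℕ (lookup s j)                 ≡⟨ Vec.lookup-map j boolToℕ s ⟨
    lookup (Vec.map boolToℕ s) j         ≡⟨ cong (λ v → lookup v j) π-rankSeq ⟨
    lookup (rankSeq (freedomRank t) π) j ≡⟨ Vec.lookup∘tabulate _ j ⟩
    h (suc (toℕ j)) ∸ h (toℕ j)          ∎

identity-rankSeq : ∀ {n} (t : Seq n) → rankSeq (freedomRank t) (identity n) ≡ Vec.map boolToℕ t
identity-rankSeq {n} t = begin
  rankSeq (freedomRank t) (identity n)        ≡⟨ Vec.tabulate-cong increment ⟩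
  tabulate (boolToℕ ∘ lookup t)               ≡⟨ Vec.tabulate-∘ boolToℕ (lookup t) ⟩
  Vec.map boolToℕ (tabulate (lookup t))       ≡⟨ cong (Vec.map boolToℕ) (Vec.tabulate∘lookup t) ⟩
  Vec.map boolToℕ t                           ∎
  where
  open ≡-Reasoning
  increment : ∀ j → freedomRank t (prefixSet (identity n) (suc (toℕ j))) ∸ freedomRank t (prefixSet (identity n) (toℕ j))
                    ≡ boolToℕ (lookup t j)
  increment j = begin
    freedomRank t (prefixSet (identity n) (suc (toℕ j))) ∸ freedomRank t (prefixSet (identity n) (toℕ j))
      ≡⟨ cong₂ _∸_ (rank-initialSegment t (suc (toℕ j)) (Fin.toℕ<n j)) (rank-initialSegment t (toℕ j) (ℕ.<⇒≤ (Fin.toℕ<n j))) ⟩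
    prefixSum (suc (toℕ j)) (toList t) ∸ prefixSum (toℕ j) (toList t)
      ≡⟨ cong (_∸ prefixSum (toℕ j) (toList t)) (prefixSum-lookup t j) ⟩
    prefixSum (toℕ j) (toList t) + boolToℕ (lookup t j) ∸ prefixSum (toℕ j) (toList t)
      ≡⟨ ℕ.m+n∸m≡n (prefixSum (toℕ j) (toList t)) _ ⟩
    boolToℕ (lookup t j) ∎

GInv-diagonal : ∀ {n} (t : Seq n) → GInv (freedomRank t) t ≢ 0
GInv-diagonal {n} t =
  filter-nonempty (rankSeq-is? (freedomRank t) t) (perms-complete (identity-isPerm n)) (identity-rankSeq t)

sum-mono : {A : Set} (L : List A) {f g : A → ℕ} → (∀ {x} → x ∈ L → f x ≤ g x) → sum (map f L) ≤ sum (map g L)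
sum-mono []      f≤g = z≤n
sum-mono (x ∷ L) f≤g = ℕ.+-mono-≤ (f≤g (here refl)) (sum-mono L (f≤g ∘ there))

sum-mono-≡ : {A : Set} (L : List A) {f g : A → ℕ} → (∀ {x} → x ∈ L → f x ≤ g x) →
             sum (map f L) ≡ sum (map g L) → ∀ {x} → x ∈ L → f x ≡ g x
sum-mono-≡ (x ∷ L) {f} {g} f≤g equal x∈ with ℕ.m≤n⇒m<n∨m≡n (f≤g (here refl))
... | inj₁ fx<gx = ⊥-elim (ℕ.<-irrefl equal (ℕ.+-mono-<-≤ fx<gx (sum-mono L (f≤g ∘ there))))
... | inj₂ fx≡gx with x∈
...   | here refl = fx≡gx
...   | there y∈  = sum-mono-≡ L (f≤g ∘ there) (ℕ.+-cancelˡ-≡ (f x) _ _ (trans equal (cong (_+ _) (sym fx≡gx)))) y∈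

-- The weight Σ_{i ≤ n} (s₁ + ⋯ + sᵢ), which strict dominance lowers.
weight : ∀ {n} → Seq n → ℕ
weight {n} s = sum (map (λ i → prefixSum i (toList s)) (upTo (suc n)))

dominated⇒lighter : ∀ {n} (s t : Seq n) → (∀ i → i ≤ n → prefixSum i (toList t) ≤ prefixSum i (toList s)) →
                    t ≢ s → weight t < weight s
dominated⇒lighter {n} s t t≼s t≢s =
  ℕ.≤∧≢⇒< (sum-mono range t≼s′) (λ same → t≢s (prefixSum-injective t s (λ i i≤n →
    sum-mono-≡ range t≼s′ same (∈-upTo⁺ (s≤s i≤n)))))
  where
  range = upTo (suc n)
  t≼s′ : ∀ {i} → i ∈ range → prefixSum i (toList t) ≤ prefixSum i (toList s)
  t≼s′ i∈ = t≼s _ (ℕ.≤-pred (∈-upTo⁻ i∈))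

open import Data.Rational using (ℚ; 0ℚ; _/_; ↥_)
open import Data.Rational.Properties using (↥-/; 0/n≡0)
import Data.Integer as ℤ
import Data.Integer.GCD as ℤ
import Data.Integer.Properties as ℤ
open TriangularSystems using (module Triangular)

ℕ/1 : ℕ → ℚ
ℕ/1 g = ℤ.+ g / 1

ℕ/1-zero : ℕ/1 0 ≡ 0ℚ
ℕ/1-zero = 0/n≡0 1

ℕ/1-nonzero : ∀ {g} → g ≢ 0 → ℕ/1 g ≢ 0ℚ
ℕ/1-nonzero {g} g≢0 g/1≡0 = g≢0 (ℤ.+-injective (begin
  ℤ.+ g                ≡⟨ ↥-/ (ℤ.+ g) 1 ⟨
  ↥ (ℕ/1 g) ℤ.* common ≡⟨ cong (λ q → ↥ q ℤ.* common) g/1≡0 ⟩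
  ℤ.0ℤ ℤ.* common      ≡⟨ ℤ.*-zeroˡ common ⟩
  ℤ.0ℤ                 ∎))
  where
  open ≡-Reasoning
  common = ℤ.gcd (ℤ.+ g) (ℤ.+ 1)

mainTheorem9 : (n r : ℕ) → r ≤ n →
    ((v : Seq n → ℚ) → Σ (Seq n → ℚ) (λ c →
       (s : Seq n) → HasOnes r s → linComb n r c s ≡ v s))
    ×
    ((c : Seq n → ℚ) → ((s : Seq n) → HasOnes r s → linComb n r c s ≡ 0ℚ) →
       (t : Seq n) → HasOnes r t → c t ≡ 0ℚ)
-- The 𝒢(F(t)) form a basis of 𝒢(n,r): their coefficient matrix is triangular
-- for the weight with nonzero diagonal, and linComb n r c s is by definition
-- the s-th coordinate  apply c s  of the corresponding combination.
mainTheorem9 n r _ = spans , independent-columns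
  where
  M : Seq n → Seq n → ℚ
  M s t = ℕ/1 (GInv (freedomRank t) s)

  triangular : ∀ {s t} → t ≢ s → M s t ≢ 0ℚ → weight t < weight s
  triangular {s} {t} t≢s Mst≢0 =
    dominated⇒lighter s t (dominated s t (λ g≡0 → Mst≢0 (trans (cong ℕ/1 g≡0) ℕ/1-zero))) t≢s

  open Triangular (seqs n r) (seqs-unique n r) weight M (λ _ _ → triangular) (λ {t} _ → ℕ/1-nonzero (GInv-diagonal t))

  spans : (v : Seq n → ℚ) → Σ (Seq n → ℚ) (λ c → (s : Seq n) → HasOnes r s → linComb n r c s ≡ v s)
  spans v = proj₁ (spanning v) , λ s hs → proj₂ (spanning v) (seqs-complete n r hs)

  independent-columns : (c : Seq n → ℚ) → ((s : Seq n) → HasOnes r s → linComb n r c s ≡ 0ℚ) →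
                        (t : Seq n) → HasOnes r t → c t ≡ 0ℚ
  independent-columns c c↦0 t ht = independent c (λ s∈ → c↦0 _ (seqs-sound n r s∈)) (seqs-complete n r ht)
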